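{- Let $p_i$ denote the $i$-th prime and let $t$ be a positive integer. For every positive integer $n$ with $n\ge p_1\cdots p_t$, $$\frac{2^{\omega(n)}}{\varphi(n)}\le\frac{2^t}{\varphi(p_1\cdots p_t)}.$$ Moreover, if $p_1\cdots p_t\le n<p_1\cdots p_{t+1}$, then $$\frac{2^{\omega(n)}}{\varphi(n)}\le\frac{2^t}{\varphi(p_1\cdots p_t)}\cdot\frac{p_1\cdots p_t}{n}.$$
   Context: $\varphi$ is Euler's totient function and $\omega(n)$ is the number of distinct prime divisors of $n$. -}

module Defs where

open import Data.Nat using (ℕ; zero; suc; _*_; _+_)
open import Data.Nat.Divisibility using (_∣?_)
open import Data.Nat.Coprimality using (coprime?)
open import Data.Nat.Primality using (Prime; prime?)
open import Data.List using (List; length; filter; map; upTo)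
open import Data.Nat.ListAction using (product)
open import Data.List.Base using (applyUpTo)
open import Relation.Nullary.Decidable using (_×-dec_)
open import Relation.Binary.PropositionalEquality using (_≡_)
open import Data.Product using (_×_)

range1 : ℕ → List ℕ
range1 n = applyUpTo suc n

-- Euler's totient: #{ 1 ≤ k ≤ n : gcd(k, n) = 1 }   (φ 0 = 0, φ 1 = 1)
φ : ℕ → ℕ
φ n = length (filter (λ k → coprime? k n) (range1 n))

ω : ℕ → ℕ
ω n = length (filter (λ p → prime? p ×-dec (p ∣? n)) (range1 n))

primeCount : ℕ → ℕ
primeCount m = length (filter prime? (range1 m))

IsIthPrime : ℕ → ℕ → Set
IsIthPrime i p = Prime p × primeCount p ≡ i

-- product p_1 ⋯ p_t of the first t values of a sequence indexed from 1 (q i = p_{i+1})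
primorialOf : (ℕ → ℕ) → ℕ → ℕ
primorialOf q t = product (map q (upTo t))

module Submission where

-- Write k = ω n, S j = p₁⋯pⱼ and T j = φ (S j) = (p₁ − 1)⋯(pⱼ − 1).  Peeling off the prime
-- factors of n one at a time, smallest first, shows S k ≤ n and n · T k ≤ φ n · S k: a prime
-- factor not seen before is at least the next unused pᵢ, and p / (p − 1) ≤ pᵢ / (pᵢ − 1) whenever
-- pᵢ ≤ p.  As pᵢ / (pᵢ − 1) > 1 the ratio bound persists for every t ≥ k, and together with
-- S t ≤ n it gives T t ≤ φ n.  When k > t, instead T k ≤ φ n and T k ≥ 2^(k − t) · T t, since
-- pᵢ ≥ 3 for i ≥ 2.  In the second claim k > t cannot happen, as then n ≥ S k ≥ S (t + 1).

open import Defs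
import Algebra.Properties.CommutativeSemigroup as CommSemigroup
open import Data.Bool using (Bool; true; false; _∧_; not)
open import Data.List using ([]; _∷_; filter; length; applyUpTo)
open import Data.List.Extrema.Nat using (min; argmin-all; min≤v⁺)
open import Data.List.Membership.Propositional using (_∈_)
open import Data.List.Membership.Propositional.Properties using (∈-applyUpTo⁻)
open import Data.List.Properties using (map-upTo)
import Data.List.Relation.Unary.All as All
open import Data.List.Relation.Unary.All.Properties using (applyUpTo⁺₂)
open import Data.List.Relation.Unary.Any as Any using (here; there)
open import Data.Nat
open import Data.Nat.Coprimality as Coprimality using (Coprime; coprime?; coprime-+; coprime-divisor)
open import Data.Nat.Divisibility
open import Data.Nat.Induction using (<-wellFounded)
open import Data.Nat.ListAction using (product)
open import Data.Nat.ListAction.Properties using (∈⇒∣product; product≢0)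
open import Data.Nat.Primality using (Prime; prime?; prime⇒irreducible; prime⇒nonTrivial; prime⇒nonZero; euclidsLemma)
open import Data.Nat.Primality.Factorisation using (factorise; factorisationHasAllPrimeFactors)
open import Data.Nat.Properties
open import Data.Product using (_×_; _,_; proj₁; proj₂; ∃-syntax)
open import Data.Sum using (_⊎_; inj₁; inj₂)
open import Function using (_∘_; mk⇔)
open import Induction.WellFounded using (Acc; acc)
open import Relation.Binary.PropositionalEquality
open import Relation.Nullary using (Dec; does; yes; no; contradiction)
open import Relation.Nullary.Decidable using (dec-true; dec-false; does-⇔; _×-dec_)
open import Relation.Unary using (Pred; Decidable)

open CommSemigroup +-commutativeSemigroup using () renaming (interchange to +-interchange)
open CommSemigroup *-commutativeSemigroup using () renaming (interchange to *-interchange)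

-- Counting over [1, n]

indicator : Bool → ℕ
indicator true  = 1
indicator false = 0

-- count f n = #{ 1 ≤ k ≤ n : f k }, recursing at the front so that shifted ranges stay definitional
count : (ℕ → Bool) → ℕ → ℕ
count f zero    = 0
count f (suc n) = indicator (f 1) + count (λ k → f (suc k)) n

length-filter-applyUpTo : ∀ {ℓ} {P : Pred ℕ ℓ} (P? : Decidable P) (g : ℕ → ℕ) n →
  length (filter P? (applyUpTo (λ k → g (suc k)) n)) ≡ count (λ k → does (P? (g k))) n
length-filter-applyUpTo P? g zero = refl
length-filter-applyUpTo P? g (suc n) with does (P? (g 1))
... | true  = cong suc (length-filter-applyUpTo P? (λ k → g (suc k)) n)
... | false = length-filter-applyUpTo P? (λ k → g (suc k)) n

length-filter-range1 : ∀ {ℓ} {P : Pred ℕ ℓ} (P? : Decidable P) n →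
  length (filter P? (range1 n)) ≡ count (λ k → does (P? k)) n
length-filter-range1 P? = length-filter-applyUpTo P? (λ k → k)

count-cong : ∀ {f g} n → (∀ k → k < n → f (suc k) ≡ g (suc k)) → count f n ≡ count g n
count-cong zero    f≗g = refl
count-cong (suc n) f≗g =
  cong₂ _+_ (cong indicator (f≗g 0 z<s)) (count-cong n (λ k k<n → f≗g (suc k) (s<s k<n)))

count-zero : ∀ {f} n → (∀ k → k < n → f (suc k) ≡ false) → count f n ≡ 0
count-zero zero    f≗false = refl
count-zero (suc n) f≗false rewrite f≗false 0 z<s =
  count-zero n (λ k k<n → f≗false (suc k) (s<s k<n))

count-+ : ∀ f m n → count f (m + n) ≡ count f m + count (λ k → f (m + k)) n
count-+ f zero    n = refl
count-+ f (suc m) n = trans (cong (indicator (f 1) +_) (count-+ (λ k → f (suc k)) m n))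
                            (sym (+-assoc (indicator (f 1)) _ _))

count-suc : ∀ f n → count f (suc n) ≡ count f n + indicator (f (suc n))
count-suc f zero    = +-comm (indicator (f 1)) 0
count-suc f (suc n) = trans (cong (indicator (f 1) +_) (count-suc (λ k → f (suc k)) n))
                            (sym (+-assoc (indicator (f 1)) _ _))

count-pad : ∀ f m n → (∀ k → f (m + suc k) ≡ false) → count f (m + n) ≡ count f m
count-pad f m n f≗false = begin
  count f (m + n)                          ≡⟨ count-+ f m n ⟩
  count f m + count (λ k → f (m + k)) n    ≡⟨ cong (count f m +_) (count-zero n (λ k _ → f≗false k)) ⟩
  count f m + 0                            ≡⟨ +-identityʳ _ ⟩
  count f m                                ∎
  where open ≡-Reasoning

count-periodic : ∀ f m → (∀ k → f (m + k) ≡ f k) → ∀ a → count f (a * m) ≡ a * count f m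
count-periodic f m periodic zero    = refl
count-periodic f m periodic (suc a) = begin
  count f (m + a * m)                          ≡⟨ count-+ f m (a * m) ⟩
  count f m + count (λ k → f (m + k)) (a * m)  ≡⟨ cong (count f m +_) shifted ⟩
  count f m + count f (a * m)                  ≡⟨ cong (count f m +_) (count-periodic f m periodic a) ⟩
  count f m + a * count f m                    ∎
  where
  open ≡-Reasoning
  shifted = count-cong (a * m) (λ k _ → periodic (suc k))

indicator-split : ∀ a b → indicator b ≡ indicator (a ∧ b) + indicator (not a ∧ b)
indicator-split true  b     = sym (+-identityʳ _)
indicator-split false true  = refl
indicator-split false false = refl

count-split : ∀ (f g : ℕ → Bool) n →
  count f n ≡ count (λ k → g k ∧ f k) n + count (λ k → not (g k) ∧ f k) n
count-split f g zero    = refl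
count-split f g (suc n) = begin
  indicator (f 1) + count (λ k → f (suc k)) n
    ≡⟨ cong₂ _+_ (indicator-split (g 1) (f 1)) (count-split (λ k → f (suc k)) (λ k → g (suc k)) n) ⟩
  (a + b) + (A + B)
    ≡⟨ +-interchange a b A B ⟩
  (a + A) + (b + B) ∎
  where
  open ≡-Reasoning
  a = indicator (g 1 ∧ f 1)
  b = indicator (not (g 1) ∧ f 1)
  A = count (λ k → g (suc k) ∧ f (suc k)) n
  B = count (λ k → not (g (suc k)) ∧ f (suc k)) n

count-multiples : ∀ p .{{_ : NonZero p}} (h : ℕ → Bool) x →
  count (λ k → does (p ∣? k) ∧ h k) (x * p) ≡ count (λ j → h (j * p)) x
count-multiples p h zero    = refl
count-multiples p@(suc p-1) h (suc x) = begin
  count F (p + x * p)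
    ≡⟨ count-+ F p (x * p) ⟩
  count F p + count (λ k → F (p + k)) (x * p)
    ≡⟨ cong₂ _+_ first-block (count-cong (x * p) (λ k _ → cong (_∧ h (p + suc k)) (∣p+k⇔∣k (suc k)))) ⟩
  indicator (h p) + count (λ k → does (p ∣? k) ∧ h (p + k)) (x * p)
    ≡⟨ cong₂ _+_ (cong (indicator ∘ h) (sym (+-identityʳ p))) (count-multiples p (λ k → h (p + k)) x) ⟩
  indicator (h (1 * p)) + count (λ j → h (p + j * p)) x ∎
  where
  open ≡-Reasoning
  F : ℕ → Bool
  F k = does (p ∣? k) ∧ h k
  ∣p+k⇔∣k : ∀ k → does (p ∣? (p + k)) ≡ does (p ∣? k)
  ∣p+k⇔∣k k = does-⇔ (mk⇔ (λ p∣p+k → ∣m+n∣m⇒∣n p∣p+k ∣-refl) (∣m∣n⇒∣m+n ∣-refl)) (p ∣? (p + k)) (p ∣? k)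
  below-p : ∀ k → k < p-1 → F (suc k) ≡ false
  below-p k k<p-1 = cong (_∧ h (suc k)) (dec-false (p ∣? suc k) (λ p∣1+k → <⇒≱ (s<s k<p-1) (∣⇒≤ p∣1+k)))
  first-block : count F p ≡ indicator (h p)
  first-block = begin
    count F p                      ≡⟨ count-suc F p-1 ⟩
    count F p-1 + indicator (F p)  ≡⟨ cong₂ _+_ (count-zero p-1 below-p)
                                              (cong (λ b → indicator (b ∧ h p)) (dec-true (p ∣? p) ∣-refl)) ⟩
    indicator (h p)                ∎

count-≟ : ∀ {p n} .{{_ : NonZero p}} → p ≤ n → count (λ k → does (k ≟ p)) n ≡ 1
count-≟ {suc zero}    {suc n} _         = cong suc (count-zero n (λ _ _ → refl))
count-≟ {suc (suc p)} {suc n} (s≤s p<n) = count-≟ {suc p} {n} p<n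

-- Euler's totient at a prime factor

coprime-*ʳ : ∀ {k m n} → Coprime k m → Coprime k n → Coprime k (m * n)
coprime-*ʳ k⊥m k⊥n (d∣k , d∣mn) =
  k⊥n (d∣k , coprime-divisor (λ (e∣d , e∣m) → k⊥m (∣-trans e∣d d∣k , e∣m)) d∣mn)

coprime-∣ʳ : ∀ {k m n} → m ∣ n → Coprime k n → Coprime k m
coprime-∣ʳ m∣n k⊥n (d∣k , d∣m) = k⊥n (d∣k , ∣-trans d∣m m∣n)

∤⇒coprime : ∀ {p k} → Prime p → p ∤ k → Coprime k p
∤⇒coprime pp p∤k (d∣k , d∣p) with prime⇒irreducible pp d∣p
... | inj₁ d≡1  = d≡1
... | inj₂ refl = contradiction d∣k p∤k

prime⇒≢1 : ∀ {p} → Prime p → p ≢ 1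
prime⇒≢1 pp = nonTrivial⇒≢1 {{prime⇒nonTrivial pp}}

coprimeTo : ℕ → ℕ → Bool
coprimeTo n k = does (coprime? k n)

φ-count : ∀ n → φ n ≡ count (coprimeTo n) n
φ-count n = length-filter-range1 (λ k → coprime? k n) n

coprimeTo-cong : ∀ {m n} k → (Coprime k m → Coprime k n) → (Coprime k n → Coprime k m) →
  coprimeTo m k ≡ coprimeTo n k
coprimeTo-cong k to from = does-⇔ (mk⇔ to from) (coprime? k _) (coprime? k _)

count-coprimeTo-* : ∀ a m → count (coprimeTo m) (a * m) ≡ a * φ m
count-coprimeTo-* a m = begin
  count (coprimeTo m) (a * m)  ≡⟨ count-periodic (coprimeTo m) m periodic a ⟩
  a * count (coprimeTo m) m    ≡⟨ cong (a *_) (φ-count m) ⟨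
  a * φ m                      ∎
  where
  open ≡-Reasoning
  periodic : ∀ k → coprimeTo m (m + k) ≡ coprimeTo m k
  periodic k = does-⇔ (mk⇔ shift coprime-+) (coprime? (m + k) m) (coprime? k m)
    where
    shift : Coprime (m + k) m → Coprime k m
    shift c (d∣k , d∣m) = c (∣m∣n⇒∣m+n d∣m d∣k , d∣m)

φ-prime-∣ : ∀ {p m} → Prime p → p ∣ m → φ (p * m) ≡ p * φ m
φ-prime-∣ {p} {m} pp p∣m = begin
  φ (p * m)                          ≡⟨ φ-count (p * m) ⟩
  count (coprimeTo (p * m)) (p * m)  ≡⟨ count-cong (p * m) (λ k _ → same-coprimes (suc k)) ⟩
  count (coprimeTo m) (p * m)        ≡⟨ count-coprimeTo-* p m ⟩
  p * φ m                            ∎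
  where
  open ≡-Reasoning
  same-coprimes : ∀ k → coprimeTo (p * m) k ≡ coprimeTo m k
  same-coprimes k = coprimeTo-cong k (coprime-∣ʳ (n∣m*n p)) (λ c → coprime-*ʳ (coprime-∣ʳ p∣m c) c)

φ-prime-∤ : ∀ {p m} → Prime p → p ∤ m → φ (p * m) ≡ (p ∸ 1) * φ m
φ-prime-∤ {p} {m} pp p∤m = begin
  φ (p * m)               ≡⟨ m+n∸n≡m (φ (p * m)) (φ m) ⟨
  φ (p * m) + φ m ∸ φ m   ≡⟨ cong₂ _∸_ φ[pm]+φ[m]≡p*φ[m] (sym (*-identityˡ (φ m))) ⟩
  p * φ m ∸ 1 * φ m       ≡⟨ *-distribʳ-∸ (φ m) p 1 ⟨
  (p ∸ 1) * φ m           ∎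
  where
  open ≡-Reasoning
  instance _ = prime⇒nonZero pp
  p∣ᵇ : ℕ → Bool
  p∣ᵇ k = does (p ∣? k)
  coprimeTo-pm : ∀ k → coprimeTo (p * m) k ≡ not (p∣ᵇ k) ∧ coprimeTo m k
  coprimeTo-pm k with p ∣? k
  ... | yes p∣k = dec-false (coprime? k (p * m)) (λ c → prime⇒≢1 pp (c (p∣k , m∣m*n m)))
  ... | no  p∤k = coprimeTo-cong k (coprime-∣ʳ (n∣m*n p)) (coprime-*ʳ (∤⇒coprime pp p∤k))
  coprimeTo-multiple : ∀ j → coprimeTo m (j * p) ≡ coprimeTo m j
  coprimeTo-multiple j = does-⇔
    (mk⇔ (Coprimality.sym ∘ coprime-∣ʳ (m∣m*n p) ∘ Coprimality.sym)
         (λ c → Coprimality.sym (coprime-*ʳ (Coprimality.sym c) (∤⇒coprime pp p∤m))))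
    (coprime? (j * p) m) (coprime? j m)
  divisible notDivisible : ℕ
  divisible    = count (λ k → p∣ᵇ k ∧ coprimeTo m k) (p * m)
  notDivisible = count (λ k → not (p∣ᵇ k) ∧ coprimeTo m k) (p * m)
  φ[pm]+φ[m]≡p*φ[m] : φ (p * m) + φ m ≡ p * φ m
  φ[pm]+φ[m]≡p*φ[m] = begin
    φ (p * m) + φ m
      ≡⟨ cong₂ _+_ (trans (φ-count (p * m)) (count-cong (p * m) (λ k _ → coprimeTo-pm (suc k))))
                   (trans (φ-count m) (count-cong m (λ k _ → sym (coprimeTo-multiple (suc k))))) ⟩
    notDivisible + count (λ j → coprimeTo m (j * p)) m
      ≡⟨ cong (notDivisible +_) (trans (cong (count _) (*-comm p m)) (count-multiples p (coprimeTo m) m)) ⟨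
    notDivisible + divisible
      ≡⟨ +-comm notDivisible divisible ⟩
    divisible + notDivisible
      ≡⟨ count-split (coprimeTo m) p∣ᵇ (p * m) ⟨
    count (coprimeTo m) (p * m)
      ≡⟨ count-coprimeTo-* p m ⟩
    p * φ m ∎

∣-prime⇒≡ : ∀ {r p} → Prime r → Prime p → r ∣ p → r ≡ p
∣-prime⇒≡ pr pp r∣p with prime⇒irreducible pp r∣p
... | inj₁ r≡1 = contradiction r≡1 (prime⇒≢1 pr)
... | inj₂ r≡p = r≡p

prime∣p*m⇒≡∨∣ : ∀ {r p m} → Prime r → Prime p → r ∣ p * m → r ≡ p ⊎ r ∣ m
prime∣p*m⇒≡∨∣ {m = m} pr pp r∣pm with euclidsLemma _ m pr r∣pm
... | inj₁ r∣p = inj₁ (∣-prime⇒≡ pr pp r∣p)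
... | inj₂ r∣m = inj₂ r∣m

primeDivisor? : ∀ n r → Dec (Prime r × r ∣ n)
primeDivisor? n r = prime? r ×-dec r ∣? n

primeDivisorOf : ℕ → ℕ → Bool
primeDivisorOf n r = does (primeDivisor? n r)

primeDivisorOf-cong : ∀ {m n} r → (Prime r → r ∣ m → r ∣ n) → (Prime r → r ∣ n → r ∣ m) →
  primeDivisorOf m r ≡ primeDivisorOf n r
primeDivisorOf-cong {m} {n} r to from =
  does-⇔ (mk⇔ (λ (pr , d) → pr , to pr d) (λ (pr , d) → pr , from pr d)) (primeDivisor? m r) (primeDivisor? n r)

ω-count-≥ : ∀ {m n} .{{_ : NonZero m}} → m ≤ n → ω m ≡ count (primeDivisorOf m) n
ω-count-≥ {m} m≤n with o , refl ← m≤n⇒∃[o]m+o≡n m≤n = begin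
  ω m                               ≡⟨ length-filter-range1 (primeDivisor? m) m ⟩
  count (primeDivisorOf m) m        ≡⟨ count-pad (primeDivisorOf m) m o too-large ⟨
  count (primeDivisorOf m) (m + o)  ∎
  where
  open ≡-Reasoning
  too-large : ∀ k → primeDivisorOf m (m + suc k) ≡ false
  too-large k = dec-false (primeDivisor? m (m + suc k)) (λ (_ , d) → <⇒≱ (m<m+n m z<s) (∣⇒≤ d))

ω-prime-∣ : ∀ {p m} .{{_ : NonZero m}} → Prime p → p ∣ m → ω (p * m) ≡ ω m
ω-prime-∣ {p} {m} pp p∣m = begin
  ω (p * m)                               ≡⟨ ω-count-≥ {p * m} ≤-refl ⟩
  count (primeDivisorOf (p * m)) (p * m)  ≡⟨ count-cong (p * m) (λ k _ → same-prime-divisors (suc k)) ⟩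
  count (primeDivisorOf m) (p * m)        ≡⟨ ω-count-≥ (m≤n*m m p) ⟨
  ω m                                     ∎
  where
  open ≡-Reasoning
  instance _ = prime⇒nonZero pp
  instance _ = m*n≢0 p m
  from-pm : ∀ {r} → Prime r → r ∣ p * m → r ∣ m
  from-pm pr r∣pm with prime∣p*m⇒≡∨∣ pr pp r∣pm
  ... | inj₁ refl = p∣m
  ... | inj₂ r∣m  = r∣m
  same-prime-divisors : ∀ r → primeDivisorOf (p * m) r ≡ primeDivisorOf m r
  same-prime-divisors r = primeDivisorOf-cong r from-pm (λ _ → ∣n⇒∣m*n p)

ω-prime-∤ : ∀ {p m} .{{_ : NonZero m}} → Prime p → p ∤ m → ω (p * m) ≡ suc (ω m)
ω-prime-∤ {p} {m} pp p∤m = begin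
  ω (p * m)
    ≡⟨ ω-count-≥ {p * m} ≤-refl ⟩
  count (primeDivisorOf (p * m)) (p * m)
    ≡⟨ count-split (primeDivisorOf (p * m)) is-p (p * m) ⟩
  count (λ k → is-p k ∧ primeDivisorOf (p * m) k) (p * m)
    + count (λ k → not (is-p k) ∧ primeDivisorOf (p * m) k) (p * m)
    ≡⟨ cong₂ _+_ (count-cong (p * m) (λ k _ → only-p (suc k)))
                 (count-cong (p * m) (λ k _ → others (suc k))) ⟩
  count is-p (p * m) + count (primeDivisorOf m) (p * m)
    ≡⟨ cong₂ _+_ (count-≟ (m≤m*n p m)) (sym (ω-count-≥ (m≤n*m m p))) ⟩
  1 + ω m ∎
  where
  open ≡-Reasoning
  instance _ = prime⇒nonZero pp
  instance _ = m*n≢0 p m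
  is-p : ℕ → Bool
  is-p k = does (k ≟ p)
  -- does (k ≟ p) computes to k ≡ᵇ p, so the cases are exposed by rewriting rather than by 'with' alone
  only-p : ∀ k → is-p k ∧ primeDivisorOf (p * m) k ≡ is-p k
  only-p k with k ≟ p
  ... | yes refl rewrite dec-true (k ≟ k) refl = dec-true (primeDivisor? (p * m) k) (pp , m∣m*n m)
  ... | no  k≢p  rewrite dec-false (k ≟ p) k≢p = refl
  others : ∀ k → not (is-p k) ∧ primeDivisorOf (p * m) k ≡ primeDivisorOf m k
  others k with k ≟ p
  ... | yes refl rewrite dec-true (k ≟ k) refl = sym (dec-false (primeDivisor? m k) (p∤m ∘ proj₂))
  ... | no  k≢p  rewrite dec-false (k ≟ p) k≢p = primeDivisorOf-cong k from-pm (λ _ → ∣n⇒∣m*n p)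
    where
    from-pm : Prime k → k ∣ p * m → k ∣ m
    from-pm pr k∣pm with prime∣p*m⇒≡∨∣ pr pp k∣pm
    ... | inj₁ k≡p = contradiction k≡p k≢p
    ... | inj₂ k∣m = k∣m

-- Primes in order

leastPrimeFactor : ∀ m .{{_ : NonTrivial m}} →
  ∃[ p ] Prime p × p ∣ m × (∀ {r} → Prime r → r ∣ m → p ≤ r)
leastPrimeFactor m with factorise m {{nonTrivial⇒nonZero m}}
... | record { factors = [] ; isFactorisation = m≡1 } = contradiction m≡1 (nonTrivial⇒≢1 {m})
... | record { factors = f ∷ fs ; isFactorisation = m≡∏ ; factorsPrime = primes } =
  min f fs , All.lookup primes min∈ , factor∣m min∈ , least
  where
  min∈ : min f fs ∈ f ∷ fs
  min∈ = argmin-all (λ x → x) {P = _∈ f ∷ fs} (here refl) (All.tabulate there)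
  factor∣m : ∀ {p} → p ∈ f ∷ fs → p ∣ m
  factor∣m p∈fs = subst (_ ∣_) (sym m≡∏) (∈⇒∣product p∈fs)
  least : ∀ {r} → Prime r → r ∣ m → min f fs ≤ r
  least pr r∣m with factorisationHasAllPrimeFactors pr (subst (_ ∣_) m≡∏ r∣m) primes
  ... | here refl  = min≤v⁺ f fs (inj₁ ≤-refl)
  ... | there r∈fs = min≤v⁺ f fs (inj₂ (Any.map (λ { refl → ≤-refl }) r∈fs))

primeCount-count : ∀ n → primeCount n ≡ count (λ k → does (prime? k)) n
primeCount-count = length-filter-range1 prime?

primeCount-mono : ∀ {m n} → m ≤ n → primeCount m ≤ primeCount n
primeCount-mono {m} m≤n with o , refl ← m≤n⇒∃[o]m+o≡n m≤n
  rewrite primeCount-count m | primeCount-count (m + o) | count-+ (λ k → does (prime? k)) m o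
  = m≤m+n _ _

primeCount-prime : ∀ {p} → Prime p → primeCount p ≡ suc (primeCount (pred p))
primeCount-prime {suc p} pp
  rewrite primeCount-count (suc p) | primeCount-count p | count-suc (λ k → does (prime? k)) p
        | dec-true (prime? (suc p)) pp
  = +-comm _ 1

primeCount-< : ∀ {m p} → m < p → Prime p → primeCount m < primeCount p
primeCount-< {m} {suc p} (s≤s m≤p) pp rewrite primeCount-prime pp = s≤s (primeCount-mono m≤p)

∏ : (ℕ → ℕ) → ℕ → ℕ
∏ f k = product (applyUpTo f k)

∏∸1 : (ℕ → ℕ) → ℕ → ℕ
∏∸1 f = ∏ (λ i → f i ∸ 1)

primorialOf≡∏ : ∀ q t → primorialOf q t ≡ ∏ q t
primorialOf≡∏ q t = cong product (map-upTo q t)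

∏-+ : ∀ f k d → ∏ f (k + d) ≡ ∏ f k * ∏ (λ i → f (k + i)) d
∏-+ f zero    d = sym (+-identityʳ _)
∏-+ f (suc k) d = trans (cong (f 0 *_) (∏-+ (λ i → f (suc i)) k d)) (sym (*-assoc (f 0) _ _))

∏-mono-≤ : ∀ {f g} → (∀ i → f i ≤ g i) → ∀ k → ∏ f k ≤ ∏ g k
∏-mono-≤ f≤g zero    = ≤-refl
∏-mono-≤ f≤g (suc k) = *-mono-≤ (f≤g 0) (∏-mono-≤ (λ i → f≤g (suc i)) k)

∏-const : ∀ c k → ∏ (λ _ → c) k ≡ c ^ k
∏-const c zero    = refl
∏-const c (suc k) = cong (c *_) (∏-const c k)

∏≢0 : ∀ {f} → (∀ i → NonZero (f i)) → ∀ k → NonZero (∏ f k)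
∏≢0 {f} f≢0 k = product≢0 (applyUpTo⁺₂ f k f≢0)

∏-monoʳ-≤ : ∀ {f} → (∀ i → NonZero (f i)) → ∀ {k l} → k ≤ l → ∏ f k ≤ ∏ f l
∏-monoʳ-≤ {f} f≢0 {k} k≤l with d , refl ← m≤n⇒∃[o]m+o≡n k≤l = begin
  ∏ f k                             ≤⟨ m≤m*n (∏ f k) (∏ (λ i → f (k + i)) d) {{∏≢0 (λ i → f≢0 (k + i)) d}} ⟩
  ∏ f k * ∏ (λ i → f (k + i)) d     ≡⟨ ∏-+ f k d ⟨
  ∏ f (k + d)                       ∎
  where open ≤-Reasoning

∏∸1≤∏ : ∀ f k → ∏∸1 f k ≤ ∏ f k
∏∸1≤∏ f = ∏-mono-≤ (λ i → m∸n≤m (f i) 1)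

φ-∏-distinctPrimes : ∀ {f} → (∀ i → Prime (f i)) → (∀ {i j} → f i ≡ f j → i ≡ j) →
  ∀ k → φ (∏ f k) ≡ ∏∸1 f k
φ-∏-distinctPrimes     primes injective zero    = refl
φ-∏-distinctPrimes {f} primes injective (suc k) = begin
  φ (f 0 * ∏ (λ i → f (suc i)) k)        ≡⟨ φ-prime-∤ (primes 0) f₀∤rest ⟩
  (f 0 ∸ 1) * φ (∏ (λ i → f (suc i)) k)  ≡⟨ cong ((f 0 ∸ 1) *_) φ-rest ⟩
  (f 0 ∸ 1) * ∏∸1 (λ i → f (suc i)) k    ∎
  where
  open ≡-Reasoning
  φ-rest = φ-∏-distinctPrimes (λ i → primes (suc i)) (λ e → suc-injective (injective e)) k
  f₀∤rest : f 0 ∤ ∏ (λ i → f (suc i)) k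
  f₀∤rest f₀∣rest
    with _ , _ , f₀≡ ← ∈-applyUpTo⁻ _ (factorisationHasAllPrimeFactors (primes 0) f₀∣rest
                                          (applyUpTo⁺₂ _ k (λ i → primes (suc i))))
    = contradiction (injective f₀≡) (λ ())

-- The totient bound along the prime factorisation

m*[n∸1]≤[m∸1]*n : ∀ {m n} → n ≤ m → m * (n ∸ 1) ≤ (m ∸ 1) * n
m*[n∸1]≤[m∸1]*n {m} {n} n≤m = begin
  m * (n ∸ 1)    ≡⟨ *-distribˡ-∸ m n 1 ⟩
  m * n ∸ m * 1  ≡⟨ cong (m * n ∸_) (*-identityʳ m) ⟩
  m * n ∸ m      ≤⟨ ∸-monoʳ-≤ (m * n) n≤m ⟩
  m * n ∸ n      ≡⟨ cong (m * n ∸_) (*-identityˡ n) ⟨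
  m * n ∸ 1 * n  ≡⟨ *-distribʳ-∸ n m 1 ⟨
  (m ∸ 1) * n    ∎
  where open ≤-Reasoning

NoPrimeGaps : (ℕ → ℕ) → Set
NoPrimeGaps s = ∀ i {r} → Prime r → s i < r → s (suc i) ≤ r

record TotientBound (s : ℕ → ℕ) (m : ℕ) : Set where
  field
    ratio : m * ∏∸1 s (ω m) ≤ φ m * ∏ s (ω m)
    size  : ∏ s (ω m) ≤ m

TotientBound-1 : ∀ s → TotientBound s 1
TotientBound-1 s = record { ratio = ≤-refl ; size = ≤-refl }

TotientBound-prime-∣ : ∀ {s p m} .{{_ : NonZero m}} → Prime p → p ∣ m →
  TotientBound s m → TotientBound s (p * m)
TotientBound-prime-∣ {s} {p} {m} pp p∣m bound = record { ratio = ratio′ ; size = size′ }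
  where
  open TotientBound bound
  instance _ = prime⇒nonZero pp
  ratio′ : p * m * ∏∸1 s (ω (p * m)) ≤ φ (p * m) * ∏ s (ω (p * m))
  ratio′ rewrite ω-prime-∣ pp p∣m | φ-prime-∣ pp p∣m
               | *-assoc p m (∏∸1 s (ω m)) | *-assoc p (φ m) (∏ s (ω m))
    = *-monoʳ-≤ p ratio
  size′ : ∏ s (ω (p * m)) ≤ p * m
  size′ rewrite ω-prime-∣ pp p∣m = ≤-trans size (m≤n*m m p)

TotientBound-prime-∤ : ∀ {s p m} .{{_ : NonZero m}} → Prime p → p ∤ m → s 0 ≤ p →
  TotientBound (λ i → s (suc i)) m → TotientBound s (p * m)
TotientBound-prime-∤ {s} {p} {m} pp p∤m s₀≤p bound = record { ratio = ratio′ ; size = size′ }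
  where
  open TotientBound bound
  S T : ℕ
  S = ∏ (λ i → s (suc i)) (ω m)
  T = ∏∸1 (λ i → s (suc i)) (ω m)
  ratio′ : p * m * ∏∸1 s (ω (p * m)) ≤ φ (p * m) * ∏ s (ω (p * m))
  ratio′ rewrite ω-prime-∤ pp p∤m | φ-prime-∤ pp p∤m = begin
    p * m * ((s 0 ∸ 1) * T)      ≡⟨ *-interchange p m (s 0 ∸ 1) T ⟩
    p * (s 0 ∸ 1) * (m * T)      ≤⟨ *-mono-≤ (m*[n∸1]≤[m∸1]*n s₀≤p) ratio ⟩
    (p ∸ 1) * s 0 * (φ m * S)    ≡⟨ *-interchange (p ∸ 1) (s 0) (φ m) S ⟩
    (p ∸ 1) * φ m * (s 0 * S)    ∎
    where open ≤-Reasoning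
  size′ : ∏ s (ω (p * m)) ≤ p * m
  size′ rewrite ω-prime-∤ pp p∤m = *-mono-≤ s₀≤p size

totientBound : ∀ {s} → NoPrimeGaps s → ∀ m .{{_ : NonZero m}} →
  (∀ {r} → Prime r → r ∣ m → s 0 ≤ r) → TotientBound s m
totientBound gaps m = go gaps m (<-wellFounded m)
  where
  go : ∀ {s} → NoPrimeGaps s → ∀ m .{{_ : NonZero m}} → Acc _<_ m →
       (∀ {r} → Prime r → r ∣ m → s 0 ≤ r) → TotientBound s m
  go {s} gaps 1 _ _ = TotientBound-1 s
  go {s} gaps m@(suc (suc _)) (acc rs) s₀≤ with p , pp , p∣m , p-least ← leastPrimeFactor m
    = subst (TotientBound s) (sym (m∣n⇒n≡m*quotient p∣m)) (peel (p ∣? m′))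
    where
    m′ = quotient p∣m
    instance _ = quotient≢0 p∣m
    m′<m : m′ < m
    m′<m = quotient-< p∣m {{prime⇒nonTrivial pp}}
    m′∣m : m′ ∣ m
    m′∣m = quotient-∣ p∣m
    peel : Dec (p ∣ m′) → TotientBound s (p * m′)
    peel (yes p∣m′) = TotientBound-prime-∣ pp p∣m′
      (go gaps m′ (rs m′<m) (λ pr r∣m′ → s₀≤ pr (∣-trans r∣m′ m′∣m)))
    peel (no p∤m′)  = TotientBound-prime-∤ pp p∤m′ (s₀≤ pp p∣m)
      (go (λ i → gaps (suc i)) m′ (rs m′<m) (λ pr r∣m′ → gaps 0 pr (s₀<r pr r∣m′)))
      where
      -- p is the least prime factor and no longer divides m′, so the prime factors of m′ exceed it
      s₀<r : ∀ {r} → Prime r → r ∣ m′ → s 0 < r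
      s₀<r pr r∣m′ = ≤-<-trans (s₀≤ pp p∣m)
        (≤∧≢⇒< (p-least pr (∣-trans r∣m′ m′∣m)) (λ { refl → p∤m′ r∣m′ }))

ratio-≤ : ∀ {s n t} → TotientBound s n → ω n ≤ t → n * ∏∸1 s t ≤ φ n * ∏ s t
ratio-≤ {s} {n} bound k≤t with d , refl ← m≤n⇒∃[o]m+o≡n k≤t = begin
  n * ∏∸1 s (k + d)                        ≡⟨ cong (n *_) (∏-+ (λ i → s i ∸ 1) k d) ⟩
  n * (∏∸1 s k * ∏∸1 (λ i → s (k + i)) d)  ≡⟨ *-assoc n _ _ ⟨
  n * ∏∸1 s k * ∏∸1 (λ i → s (k + i)) d    ≤⟨ *-mono-≤ ratio (∏∸1≤∏ (λ i → s (k + i)) d) ⟩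
  φ n * ∏ s k * ∏ (λ i → s (k + i)) d      ≡⟨ *-assoc (φ n) _ _ ⟩
  φ n * (∏ s k * ∏ (λ i → s (k + i)) d)    ≡⟨ cong (φ n *_) (∏-+ s k d) ⟨
  φ n * ∏ s (k + d)                        ∎
  where
  open ≤-Reasoning
  open TotientBound bound
  k = ω n

∏∸1≤φ : ∀ {s n t} → (∀ i → NonZero (s i)) → TotientBound s n → ω n ≤ t → ∏ s t ≤ n → ∏∸1 s t ≤ φ n
∏∸1≤φ {s} {n} {t} s≢0 bound k≤t ∏≤n = *-cancelʳ-≤ (∏∸1 s t) (φ n) (∏ s t) {{∏≢0 s≢0 t}} (begin
  ∏∸1 s t * ∏ s t  ≤⟨ *-monoʳ-≤ (∏∸1 s t) ∏≤n ⟩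
  ∏∸1 s t * n      ≡⟨ *-comm (∏∸1 s t) n ⟩
  n * ∏∸1 s t      ≤⟨ ratio-≤ bound k≤t ⟩
  φ n * ∏ s t      ∎)
  where open ≤-Reasoning

2^*∏∸1≤ : ∀ {s t k} → t ≤ k → (∀ i → 3 ≤ s (t + i)) → 2 ^ k * ∏∸1 s t ≤ 2 ^ t * ∏∸1 s k
2^*∏∸1≤ {s} {t} t≤k 3≤s with d , refl ← m≤n⇒∃[o]m+o≡n t≤k = begin
  2 ^ (t + d) * ∏∸1 s t        ≡⟨ cong (_* ∏∸1 s t) (^-distribˡ-+-* 2 t d) ⟩
  2 ^ t * 2 ^ d * ∏∸1 s t      ≡⟨ *-assoc (2 ^ t) _ _ ⟩
  2 ^ t * (2 ^ d * ∏∸1 s t)    ≤⟨ *-monoʳ-≤ (2 ^ t) (*-monoˡ-≤ (∏∸1 s t) 2^d≤T) ⟩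
  2 ^ t * (T * ∏∸1 s t)        ≡⟨ cong (2 ^ t *_) (trans (*-comm T (∏∸1 s t)) (sym (∏-+ (λ i → s i ∸ 1) t d))) ⟩
  2 ^ t * ∏∸1 s (t + d)        ∎
  where
  open ≤-Reasoning
  T = ∏∸1 (λ i → s (t + i)) d
  2^d≤T : 2 ^ d ≤ T
  2^d≤T = ≤-trans (≤-reflexive (sym (∏-const 2 d))) (∏-mono-≤ (λ i → ∸-monoˡ-≤ 1 (3≤s i)) d)

module PrimeEnumeration {q : ℕ → ℕ} (q-ith : ∀ i → IsIthPrime (suc i) (q i)) where

  q-prime : ∀ i → Prime (q i)
  q-prime i = proj₁ (q-ith i)

  q≢0 : ∀ i → NonZero (q i)
  q≢0 i = prime⇒nonZero (q-prime i)

  primeCount-q : ∀ i → primeCount (q i) ≡ suc i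
  primeCount-q i = proj₂ (q-ith i)

  q-injective : ∀ {i j} → q i ≡ q j → i ≡ j
  q-injective {i} {j} qi≡qj =
    suc-injective (trans (sym (primeCount-q i)) (trans (cong primeCount qi≡qj) (primeCount-q j)))

  q-noPrimeGaps : NoPrimeGaps q
  q-noPrimeGaps i {r} pr qi<r = ≮⇒≥ λ r<qi+1 → <⇒≱
    (subst (primeCount r <_) (primeCount-q (suc i)) (primeCount-< r<qi+1 (q-prime (suc i))))
    (subst (_< primeCount r) (primeCount-q i) (primeCount-< qi<r pr))

  q₀-least : ∀ {r} → Prime r → q 0 ≤ r
  q₀-least {r} pr = ≮⇒≥ λ r<q₀ → contradiction
    (subst₂ _<_ (primeCount-prime pr) (primeCount-q 0) (primeCount-< r<q₀ (q-prime 0)))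
    λ { (s≤s ()) }

  3≤q : ∀ {i} → 1 ≤ i → 3 ≤ q i
  3≤q {i} 1≤i = ≮⇒≥ λ qi<3 → <⇒≱ (s≤s 1≤i)
    (subst (_≤ 1) (primeCount-q i) (primeCount-mono (≤-pred qi<3)))

  φ-primorial : ∀ t → φ (∏ q t) ≡ ∏∸1 q t
  φ-primorial = φ-∏-distinctPrimes q-prime q-injective

lemma2p9 : (q : ℕ → ℕ) → (∀ i → IsIthPrime (suc i) (q i)) → (t : ℕ) → 1 ≤ t → (n : ℕ) → 1 ≤ n → primorialOf q t ≤ n →
    (2 ^ ω n * φ (primorialOf q t) ≤ 2 ^ t * φ n)
    × (n < primorialOf q (suc t) → 2 ^ ω n * φ (primorialOf q t) * n ≤ 2 ^ t * φ n * primorialOf q t)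
lemma2p9 q q-ith t 1≤t n 1≤n primorial≤n
  rewrite primorialOf≡∏ q t | primorialOf≡∏ q (suc t) | PrimeEnumeration.φ-primorial q-ith t
  = part₁ , part₂
  where
  open PrimeEnumeration q-ith
  instance _ = >-nonZero 1≤n
  bound : TotientBound q n
  bound = totientBound q-noPrimeGaps n (λ pr _ → q₀-least pr)
  k = ω n
  part₁ : 2 ^ k * ∏∸1 q t ≤ 2 ^ t * φ n
  part₁ with k ≤? t
  ... | yes k≤t = *-mono-≤ (^-monoʳ-≤ 2 k≤t) (∏∸1≤φ q≢0 bound k≤t primorial≤n)
  ... | no  k≰t = ≤-trans (2^*∏∸1≤ {q} (<⇒≤ (≰⇒> k≰t)) (λ i → 3≤q (≤-trans 1≤t (m≤m+n t i))))
                          (*-monoʳ-≤ (2 ^ t) (∏∸1≤φ q≢0 bound ≤-refl (TotientBound.size bound)))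
  part₂ : n < ∏ q (suc t) → 2 ^ k * ∏∸1 q t * n ≤ 2 ^ t * φ n * ∏ q t
  part₂ n<∏ with k ≤? t
  ... | yes k≤t = begin
    2 ^ k * ∏∸1 q t * n    ≡⟨ *-assoc (2 ^ k) _ _ ⟩
    2 ^ k * (∏∸1 q t * n)  ≤⟨ *-mono-≤ (^-monoʳ-≤ 2 k≤t) (≤-reflexive (*-comm (∏∸1 q t) n)) ⟩
    2 ^ t * (n * ∏∸1 q t)  ≤⟨ *-monoʳ-≤ (2 ^ t) (ratio-≤ bound k≤t) ⟩
    2 ^ t * (φ n * ∏ q t)  ≡⟨ *-assoc (2 ^ t) _ _ ⟨
    2 ^ t * φ n * ∏ q t    ∎
    where open ≤-Reasoning
  ... | no  k≰t = contradiction (≤-trans (∏-monoʳ-≤ q≢0 (≰⇒> k≰t)) (TotientBound.size bound)) (<⇒≱ n<∏)
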